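{- Let $k\in\mathbb{Z}$ and $n,d\in\mathbb{Z}^+$. If $T_{2,d}$ admits a closed coloring with remainder $k\bmod n$, then it admits a closed coloring with remainder $k\bmod n$ in which all vertices within each level of $T_{2,d}$ receive the same label.
   Context: $T_{2,d}$ is the rooted perfect binary tree of height $d$: the root is at level $0$, every vertex at level $i<d$ has exactly two children at level $i+1$, and level $d$ consists of leaves. A closed coloring with remainder $k\bmod n$ of a graph $G=(V,E)$ is a map $\ell:V\to\mathbb{Z}$ with $\sum_{w\in N[v]}\ell(w)\equiv k\pmod n$ for every $v\in V$, where $N[v]$ is the closed neighborhood of $v$. -}

module Defs where

open import Data.Nat as ℕ using (ℕ; zero; suc; _≤_; _<ᵇ_)
open import Data.Bool using (Bool; true; false; if_then_else_)
open import Data.Vec using (Vec; []; _∷_)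
open import Data.Integer using (ℤ; +_; _+_; _-_)
open import Data.Integer.Divisibility using (_∣_)

-- Vertices of T_{2,d}: a vertex at level i (0 ≤ i ≤ d) is the path from the
-- root to it, a vector of i bits (the most recent step is the head).
-- The root is [] (level 0); the children of w at level i < d are
-- true ∷ w and false ∷ w (level i+1); the parent of b ∷ w is w.
-- A labeling assigns an integer to every vertex; it is given as a function
-- on all bit vectors, and only its values at levels ≤ d matter.
Labeling : Set
Labeling = (i : ℕ) → Vec Bool i → ℤ

parentTerm : Labeling → (i : ℕ) → Vec Bool i → ℤ
parentTerm ℓ zero    []      = + 0
parentTerm ℓ (suc j) (b ∷ w) = ℓ j w

childTerm : (d : ℕ) → Labeling → (i : ℕ) → Vec Bool i → ℤ
childTerm d ℓ i w =
  if i <ᵇ d then ℓ (suc i) (true ∷ w) + ℓ (suc i) (false ∷ w) else + 0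

closedSum : (d : ℕ) → Labeling → (i : ℕ) → Vec Bool i → ℤ
closedSum d ℓ i w = ℓ i w + parentTerm ℓ i w + childTerm d ℓ i w

IsClosedColoring : (d n : ℕ) (k : ℤ) → Labeling → Set
IsClosedColoring d n k ℓ =
  (i : ℕ) → i ≤ d → (w : Vec Bool i) → (+ n) ∣ (closedSum d ℓ i w - k)

LevelConstant : (d : ℕ) → Labeling → Set
LevelConstant d ℓ = (i : ℕ) → i ≤ d → (w w′ : Vec Bool i) → ℓ i w ≡ ℓ i w′
  where open import Relation.Binary.PropositionalEquality using (_≡_)

-- In a level-constant labeling that satisfies the closed condition at every vertex below
-- height m, the label at height m is an affine function x_m(t) = x_m(0) + A_m t of the
-- leaf label t, and A_m is odd.  By induction from the leaves, for any closed coloring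
-- every vertex v of height m has a t with ℓ(v) ≡ x_m(t) and ℓ(parent v) ≡ x_{m+1}(t)
-- (mod n): the children of v give t₁ and t₂ with A_{m+1} t₁ ≡ A_{m+1} t₂, and because
-- A_{m+1} = 1 + 2h is odd, t = t₁ + h (t₁ - t₂) satisfies both A_{m+1} t ≡ A_{m+1} t₁ and
-- 2t ≡ t₁ + t₂, which is what the closed condition at v requires.  At the root the parent
-- term is 0, so x_{d+1}(t) ≡ 0, which is the closed condition at the root of the
-- level-constant coloring with leaf label t.
module Submission where

open import Defs
open import Data.Nat using (ℕ; _≥_)
open import Data.Integer using (ℤ)
open import Data.Product using (Σ; _×_)

open import Data.Bool using (Bool; true; false)
open import Data.Empty using (⊥-elim)
open import Data.Integer using (+_; _+_; _-_; _*_; -_)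
open import Data.Integer.Divisibility.Signed
  using (∣ᵤ⇒∣; ∣⇒∣ᵤ; ∣-refl; ∣m∣n⇒∣m+n; ∣m∣n⇒∣m-n; ∣m⇒∣-m; ∣n⇒∣m*n)
  renaming (_∣_ to _∣ₛ_)
open import Data.Integer.Tactic.RingSolver using (solve-∀)
import Data.Nat as ℕ
open import Data.Nat using (zero; suc; _≤_; _<_; _∸_; _<ᵇ_; z<s)
open import Data.Nat.Properties
  using (<⇒<ᵇ; <ᵇ⇒<; <⇒≱; ≤-reflexive; m≤n⇒m<n∨m≡n; <⇒≤; ≤-refl; n∸n≡0; +-∸-assoc; +-suc; +-identityʳ; m<m+n)
open import Data.Product using (_,_)
open import Data.Sum using (inj₁; inj₂)
open import Data.Vec using (Vec; []; _∷_)
open import Function.Bundles using (_⇔_; mk⇔; Equivalence)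
open import Level using (0ℓ)
open import Relation.Binary.Bundles using (Setoid)
open import Relation.Binary.PropositionalEquality using (_≡_; refl; sym; trans; cong; cong₂; subst)
import Relation.Binary.Reasoning.Setoid as SetoidReasoning

infix 4 _≡_mod_

record _≡_mod_ (a b : ℤ) (n : ℕ) : Set where
  constructor ∣⇒≡mod
  field ≡mod⇒∣ : + n ∣ₛ a - b

open _≡_mod_

module _ {n : ℕ} where

  ≡mod-fromDifference : ∀ {a b e} → a - b ≡ e → + n ∣ₛ e → a ≡ b mod n
  ≡mod-fromDifference a-b≡e n∣e = ∣⇒≡mod (subst (+ n ∣ₛ_) (sym a-b≡e) n∣e)

  ≡⇒≡mod : ∀ {a b} → a ≡ b → a ≡ b mod n
  ≡⇒≡mod {a} refl = ≡mod-fromDifference (a-a≡0*n a (+ n)) (∣n⇒∣m*n (+ 0) ∣-refl)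
    where
    a-a≡0*n : ∀ a n → a - a ≡ + 0 * n
    a-a≡0*n = solve-∀

  ≡mod-sym : ∀ {a b} → a ≡ b mod n → b ≡ a mod n
  ≡mod-sym {a} {b} a≡b = ≡mod-fromDifference (negate a b) (∣m⇒∣-m (≡mod⇒∣ a≡b))
    where
    negate : ∀ a b → b - a ≡ - (a - b)
    negate = solve-∀

  ≡mod-trans : ∀ {a b c} → a ≡ b mod n → b ≡ c mod n → a ≡ c mod n
  ≡mod-trans {a} {b} {c} a≡b b≡c =
    ≡mod-fromDifference (telescope a b c) (∣m∣n⇒∣m+n (≡mod⇒∣ a≡b) (≡mod⇒∣ b≡c))
    where
    telescope : ∀ a b c → a - c ≡ (a - b) + (b - c)
    telescope = solve-∀

  +-cong-≡mod : ∀ {a b c d} → a ≡ b mod n → c ≡ d mod n → a + c ≡ b + d mod n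
  +-cong-≡mod {a} {b} {c} {d} a≡b c≡d =
    ≡mod-fromDifference (regroup a b c d) (∣m∣n⇒∣m+n (≡mod⇒∣ a≡b) (≡mod⇒∣ c≡d))
    where
    regroup : ∀ a b c d → (a + c) - (b + d) ≡ (a - b) + (c - d)
    regroup = solve-∀

  -‿cong-≡mod : ∀ {a b c d} → a ≡ b mod n → c ≡ d mod n → a - c ≡ b - d mod n
  -‿cong-≡mod {a} {b} {c} {d} a≡b c≡d =
    ≡mod-fromDifference (regroup a b c d) (∣m∣n⇒∣m-n (≡mod⇒∣ a≡b) (≡mod⇒∣ c≡d))
    where
    regroup : ∀ a b c d → (a - c) - (b - d) ≡ (a - b) - (c - d)
    regroup = solve-∀

  *-congˡ-≡mod : ∀ c {a b} → a ≡ b mod n → c * a ≡ c * b mod n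
  *-congˡ-≡mod c {a} {b} a≡b = ≡mod-fromDifference (distrib c a b) (∣n⇒∣m*n c (≡mod⇒∣ a≡b))
    where
    distrib : ∀ c a b → c * a - c * b ≡ c * (a - b)
    distrib = solve-∀

≡mod-setoid : ℕ → Setoid 0ℓ 0ℓ
≡mod-setoid n = record
  { Carrier       = ℤ
  ; _≈_           = _≡_mod n
  ; isEquivalence = record
    { refl  = ≡⇒≡mod refl
    ; sym   = ≡mod-sym
    ; trans = ≡mod-trans
    }
  }

-- levelLabel k t m is the label at height m (distance m above the leaves) of the
-- level-constant labeling with leaf label t whose closed condition holds exactly at
-- every vertex of height < m; the condition at height m determines height m + 1.
levelLabel  : ℤ → ℤ → ℕ → ℤ
childrenSum : ℤ → ℤ → ℕ → ℤ

levelLabel k t zero    = t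
levelLabel k t (suc m) = k - levelLabel k t m - childrenSum k t m

childrenSum k t zero    = + 0
childrenSum k t (suc m) = levelLabel k t m + levelLabel k t m

slope : ℕ → ℤ
slope = levelLabel (+ 0) (+ 1)

levelLabel-affine  : ∀ k t m → levelLabel k t m ≡ levelLabel k (+ 0) m + slope m * t
childrenSum-affine : ∀ k t m → childrenSum k t m ≡ childrenSum k (+ 0) m + childrenSum (+ 0) (+ 1) m * t

levelLabel-affine k t zero = t≡0+1*t t
  where
  t≡0+1*t : ∀ t → t ≡ + 0 + + 1 * t
  t≡0+1*t = solve-∀
levelLabel-affine k t (suc m) =
  trans (cong₂ (λ x c → k - x - c) (levelLabel-affine k t m) (childrenSum-affine k t m))
        (regroup k (levelLabel k (+ 0) m) (slope m) (childrenSum k (+ 0) m) (childrenSum (+ 0) (+ 1) m) t)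
  where
  regroup : ∀ k x a c b t → k - (x + a * t) - (c + b * t) ≡ (k - x - c) + (+ 0 - a - b) * t
  regroup = solve-∀

childrenSum-affine k t zero = 0≡0+0*t t
  where
  0≡0+0*t : ∀ t → + 0 ≡ + 0 + + 0 * t
  0≡0+0*t = solve-∀
childrenSum-affine k t (suc m) =
  trans (cong (λ x → x + x) (levelLabel-affine k t m))
        (regroup (levelLabel k (+ 0) m) (slope m) t)
  where
  regroup : ∀ x a t → (x + a * t) + (x + a * t) ≡ (x + x) + (a + a) * t
  regroup = solve-∀

levelLabel-difference : ∀ k t s m → levelLabel k t m - levelLabel k s m ≡ slope m * t - slope m * s
levelLabel-difference k t s m =
  trans (cong₂ _-_ (levelLabel-affine k t m) (levelLabel-affine k s m))
        (cancel (levelLabel k (+ 0) m) (slope m * t) (slope m * s))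
  where
  cancel : ∀ x y z → (x + y) - (x + z) ≡ y - z
  cancel = solve-∀

Odd : ℤ → Set
Odd a = Σ ℤ λ h → a ≡ + 1 + + 2 * h

slope-odd : ∀ m → Odd (slope m)
slope-odd zero          = + 0 , refl
slope-odd (suc zero)    = - + 1 , refl
slope-odd (suc (suc m)) =
  let h , a≡1+2h = slope-odd (suc m) in
  - + 1 - h - slope m ,
  trans (cong (λ a → + 0 - a - (slope m + slope m)) a≡1+2h) (regroup h (slope m))
  where
  regroup : ∀ h s → + 0 - (+ 1 + + 2 * h) - (s + s) ≡ + 1 + + 2 * (- + 1 - h - s)
  regroup = solve-∀

module _ {n : ℕ} where
  open SetoidReasoning (≡mod-setoid n)

  ∃-midpoint : ∀ {a} → Odd a → ∀ t₁ t₂ → a * t₁ ≡ a * t₂ mod n →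
    Σ ℤ λ t → a * t ≡ a * t₁ mod n × t + t ≡ t₁ + t₂ mod n
  ∃-midpoint {a} (h , refl) t₁ t₂ at₁≡at₂ =
    t₁ + h * (t₁ - t₂) ,
    ≡mod-fromDifference (shift a h t₁ t₂) (∣n⇒∣m*n h (≡mod⇒∣ at₁≡at₂)) ,
    ≡mod-fromDifference (double h t₁ t₂) (≡mod⇒∣ at₁≡at₂)
    where
    shift : ∀ a h t₁ t₂ → a * (t₁ + h * (t₁ - t₂)) - a * t₁ ≡ h * (a * t₁ - a * t₂)
    shift = solve-∀
    double : ∀ h t₁ t₂ → let a = + 1 + + 2 * h in
      (t₁ + h * (t₁ - t₂)) + (t₁ + h * (t₁ - t₂)) - (t₁ + t₂) ≡ a * t₁ - a * t₂
    double = solve-∀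

  levelLabel-≡mod⇔slope-≡mod : ∀ k t s m →
    levelLabel k t m ≡ levelLabel k s m mod n ⇔ slope m * t ≡ slope m * s mod n
  levelLabel-≡mod⇔slope-≡mod k t s m = mk⇔
    (λ x≡y → ∣⇒≡mod (subst (+ n ∣ₛ_) difference (≡mod⇒∣ x≡y)))
    (λ at≡as → ∣⇒≡mod (subst (+ n ∣ₛ_) (sym difference) (≡mod⇒∣ at≡as)))
    where
    difference : levelLabel k t m - levelLabel k s m ≡ slope m * t - slope m * s
    difference = levelLabel-difference k t s m

  childrenSum-midpoint : ∀ {k} t t₁ t₂ m → t + t ≡ t₁ + t₂ mod n →
    levelLabel k t₁ m + levelLabel k t₂ m ≡ childrenSum k t (suc m) mod n
  childrenSum-midpoint {k} t t₁ t₂ m 2t≡t₁+t₂ = begin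
    levelLabel k t₁ m + levelLabel k t₂ m
      ≡⟨ cong₂ _+_ (levelLabel-affine k t₁ m) (levelLabel-affine k t₂ m) ⟩
    (x + a * t₁) + (x + a * t₂)   ≡⟨ collect x a t₁ t₂ ⟩
    (x + x) + a * (t₁ + t₂)       ≈⟨ +-cong-≡mod (≡⇒≡mod {a = x + x} refl) (*-congˡ-≡mod a (≡mod-sym 2t≡t₁+t₂)) ⟩
    (x + x) + a * (t + t)         ≡⟨ collect x a t t ⟨
    (x + a * t) + (x + a * t)     ≡⟨ cong (λ y → y + y) (levelLabel-affine k t m) ⟨
    childrenSum k t (suc m)       ∎
    where
    x a : ℤ
    x = levelLabel k (+ 0) m
    a = slope m
    collect : ∀ x a t₁ t₂ → (x + a * t₁) + (x + a * t₂) ≡ (x + x) + a * (t₁ + t₂)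
    collect = solve-∀

  closed⇒parent : ∀ {k u p c} t m → u ≡ levelLabel k t m mod n → c ≡ childrenSum k t m mod n →
    u + p + c ≡ k mod n → p ≡ levelLabel k t (suc m) mod n
  closed⇒parent {k} {u} {p} {c} t m u≡x c≡s closed = begin
    p                       ≡⟨ isolate u p c ⟩
    u + p + c - u - c       ≈⟨ -‿cong-≡mod (-‿cong-≡mod closed u≡x) c≡s ⟩
    k - levelLabel k t m - childrenSum k t m ∎
    where
    isolate : ∀ u p c → p ≡ u + p + c - u - c
    isolate = solve-∀

  parent⇒closed : ∀ {k u p c} t m → u ≡ levelLabel k t m mod n → c ≡ childrenSum k t m mod n →
    p ≡ levelLabel k t (suc m) mod n → u + p + c ≡ k mod n
  parent⇒closed {k} {u} {p} {c} t m u≡x c≡s p≡x′ = begin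
    u + p + c           ≈⟨ +-cong-≡mod (+-cong-≡mod u≡x p≡x′) c≡s ⟩
    x + (k - x - s) + s ≡⟨ cancel k x s ⟩
    k                   ∎
    where
    x s : ℤ
    x = levelLabel k t m
    s = childrenSum k t m
    cancel : ∀ k x s → x + (k - x - s) + s ≡ k
    cancel = solve-∀

  mergeParameters : ∀ {k u c₁ c₂} t₁ t₂ m →
    c₁ ≡ levelLabel k t₁ m mod n → u ≡ levelLabel k t₁ (suc m) mod n →
    c₂ ≡ levelLabel k t₂ m mod n → u ≡ levelLabel k t₂ (suc m) mod n →
    Σ ℤ λ t → u ≡ levelLabel k t (suc m) mod n × c₁ + c₂ ≡ childrenSum k t (suc m) mod n
  mergeParameters {k} t₁ t₂ m c₁≡x₁ u≡x₁′ c₂≡x₂ u≡x₂′ =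
    let t , at≡at₁ , 2t≡t₁+t₂ = ∃-midpoint (slope-odd (suc m)) t₁ t₂ at₁≡at₂ in
    t ,
    ≡mod-trans u≡x₁′ (Equivalence.from (levelLabel-≡mod⇔slope-≡mod k t₁ t (suc m)) (≡mod-sym at≡at₁)) ,
    ≡mod-trans (+-cong-≡mod c₁≡x₁ c₂≡x₂) (childrenSum-midpoint t t₁ t₂ m 2t≡t₁+t₂)
    where
    at₁≡at₂ : slope (suc m) * t₁ ≡ slope (suc m) * t₂ mod n
    at₁≡at₂ = Equivalence.to (levelLabel-≡mod⇔slope-≡mod k t₁ t₂ (suc m)) (≡mod-trans (≡mod-sym u≡x₁′) u≡x₂′)

childTerm-inner : ∀ {d i} ℓ (w : Vec Bool i) → i < d →
  childTerm d ℓ i w ≡ ℓ (suc i) (true ∷ w) + ℓ (suc i) (false ∷ w)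
childTerm-inner {d} {i} ℓ w i<d with i <ᵇ d | <⇒<ᵇ i<d
... | true  | _  = refl
... | false | ()

childTerm-leaf : ∀ {d i} ℓ (w : Vec Bool i) → d ≤ i → childTerm d ℓ i w ≡ + 0
childTerm-leaf {d} {i} ℓ w d≤i with i <ᵇ d | <ᵇ⇒< i d
... | false | _    = refl
... | true  | i<d = ⊥-elim (<⇒≱ (i<d _) d≤i)

module _ {d n : ℕ} {k : ℤ} {ℓ : Labeling} (closed : IsClosedColoring d n k ℓ) where

  closedAt : ∀ {i} → i ≤ d → (w : Vec Bool i) → closedSum d ℓ i w ≡ k mod n
  closedAt i≤d w = ∣⇒≡mod (∣ᵤ⇒∣ (closed _ i≤d w))

  effectiveLeafLabel : ∀ m {i} → i ℕ.+ m ≡ d → (w : Vec Bool i) →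
    Σ ℤ λ t → ℓ i w ≡ levelLabel k t m mod n × parentTerm ℓ i w ≡ levelLabel k t (suc m) mod n
  effectiveLeafLabel zero {i} i+0≡d w =
    ℓ i w , ≡⇒≡mod refl ,
    closed⇒parent (ℓ i w) zero (≡⇒≡mod refl) (≡⇒≡mod (childTerm-leaf ℓ w d≤i)) (closedAt i≤d w)
    where
    d≤i : d ≤ i
    d≤i = ≤-reflexive (trans (sym i+0≡d) (+-identityʳ i))
    i≤d : i ≤ d
    i≤d = ≤-reflexive (trans (sym (+-identityʳ i)) i+0≡d)
  effectiveLeafLabel (suc m) {i} i+1+m≡d w =
    let t₁ , c₁≡x₁ , u≡x₁′ = effectiveLeafLabel m 1+i+m≡d (true ∷ w)
        t₂ , c₂≡x₂ , u≡x₂′ = effectiveLeafLabel m 1+i+m≡d (false ∷ w)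
        t  , u≡x′  , c₁+c₂≡s = mergeParameters t₁ t₂ m c₁≡x₁ u≡x₁′ c₂≡x₂ u≡x₂′
    in t , u≡x′ ,
       closed⇒parent t (suc m) u≡x′ (≡mod-trans (≡⇒≡mod (childTerm-inner ℓ w i<d)) c₁+c₂≡s)
                     (closedAt (<⇒≤ i<d) w)
    where
    1+i+m≡d : suc i ℕ.+ m ≡ d
    1+i+m≡d = trans (sym (+-suc i m)) i+1+m≡d
    i<d : i < d
    i<d = subst (i <_) i+1+m≡d (m<m+n i z<s)

levelConstantLabeling : ℤ → ℤ → ℕ → Labeling
levelConstantLabeling k t d i _ = levelLabel k t (d ∸ i)

module _ {n : ℕ} (k t : ℤ) (d : ℕ) where

  childTerm-levelConstant : ∀ {i} (w : Vec Bool i) → i ≤ d →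
    childTerm d (levelConstantLabeling k t d) i w ≡ childrenSum k t (d ∸ i)
  childTerm-levelConstant w i≤d with m≤n⇒m<n∨m≡n i≤d
  ... | inj₁ i<d  = trans (childTerm-inner (levelConstantLabeling k t d) w i<d)
                          (cong (childrenSum k t) (sym (+-∸-assoc 1 i<d)))
  ... | inj₂ refl = trans (childTerm-leaf (levelConstantLabeling k t d) w ≤-refl)
                          (cong (childrenSum k t) (sym (n∸n≡0 d)))

  -- The root has no parent (its parent term is 0), so the closed condition at the root
  -- asks that the label the recurrence assigns to height d + 1 vanish.
  parentTerm-levelConstant : + 0 ≡ levelLabel k t (suc d) mod n → ∀ i → i ≤ d → (w : Vec Bool i) →
    parentTerm (levelConstantLabeling k t d) i w ≡ levelLabel k t (suc (d ∸ i)) mod n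
  parentTerm-levelConstant root zero    _   []      = root
  parentTerm-levelConstant root (suc i) i<d (_ ∷ w) = ≡⇒≡mod (cong (levelLabel k t) (+-∸-assoc 1 i<d))

  levelConstantLabeling-closed : + 0 ≡ levelLabel k t (suc d) mod n →
    IsClosedColoring d n k (levelConstantLabeling k t d)
  levelConstantLabeling-closed root i i≤d w = ∣⇒∣ᵤ (≡mod⇒∣
    (parent⇒closed t (d ∸ i) (≡⇒≡mod refl) (≡⇒≡mod (childTerm-levelConstant w i≤d))
                   (parentTerm-levelConstant root i i≤d w)))

lemma6p4 : (k : ℤ) (n d : ℕ) → n ≥ 1 → d ≥ 1 →
    Σ Labeling (IsClosedColoring d n k) →
    Σ Labeling (λ ℓ → IsClosedColoring d n k ℓ × LevelConstant d ℓ)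
lemma6p4 k n d _ _ (ℓ , closed) =
  let t , _ , root = effectiveLeafLabel {k = k} {ℓ} closed d refl [] in
  levelConstantLabeling k t d , levelConstantLabeling-closed k t d root , λ _ _ _ _ → refl
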